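{- Let $G=(V,E)$ be a graph, $T$ any $4$-Steiner root of $G$, and $S$ a minimal separator of $G$. If $T\langle S\rangle$ is a non-edge star, then $S$ is weakly $\mathcal{T}_G$-convergent for every clique-tree $\mathcal{T}_G$ of $G$.
   Context: A $4$-Steiner root of $G$ is a tree $T$ with $V\subseteq V(T)$ such that for distinct $u,v\in V$, $uv\in E$ iff $\mathrm{dist}_T(u,v)\le4$. $T\langle X\rangle$ is the smallest subtree of $T$ containing $X$. A non-edge star is a tree of diameter exactly $2$. A clique-tree of a chordal graph is a tree whose nodes are its maximal cliques such that for each vertex the cliques containing it induce a subtree; an edge $KK'$ is labeled by the minimal separator $K\cap K'$. A minimal separator $S$ is weakly $\mathcal{T}_G$-convergent if some maximal clique is incident to every edge of $\mathcal{T}_G$ labeled by a minimal separator $S'\supsetneq S$. -}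

module Defs where

open import Data.Nat using (ℕ; zero; suc; _≤_)
open import Data.Fin using (Fin)
open import Data.Fin.Subset using (Subset; _∈_; _∉_; _⊆_; _⊂_; _∩_)
open import Data.Bool using (Bool; true; false)
open import Data.Product using (Σ; ∃; _×_; _,_)
open import Data.Sum using (_⊎_)
open import Relation.Binary.PropositionalEquality using (_≡_; _≢_)
open import Relation.Nullary using (¬_)
open import Function.Bundles using (_⇔_)

record Graph (n : ℕ) : Set where
  field
    edge   : Fin n → Fin n → Bool
    sym    : ∀ x y → edge x y ≡ edge y x
    irrefl : ∀ x → edge x x ≡ false

open Graph public

Adj : ∀ {n} → Graph n → Fin n → Fin n → Set
Adj G x y = edge G x y ≡ true

data Walk {n : ℕ} (R : Fin n → Fin n → Set) : Fin n → Fin n → ℕ → Set where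
  here : ∀ {x} → Walk R x x 0
  step : ∀ {x y z k} → R x y → Walk R y z k → Walk R x z (suc k)

AdjIn : ∀ {n} → Graph n → Subset n → Fin n → Fin n → Set
AdjIn G X x y = x ∈ X × y ∈ X × Adj G x y

DistLe : ∀ {n} → (Fin n → Fin n → Set) → ℕ → Fin n → Fin n → Set
DistLe R k x y = ∃ λ j → j ≤ k × Walk R x y j

Connected : ∀ {n} → Graph n → Set
Connected G = ∀ x y → ∃ λ k → Walk (Adj G) x y k

record Cycle {n : ℕ} (G : Graph n) : Set where
  field
    len   : ℕ
    vtx   : Fin (suc (suc (suc len))) → Fin n
    inj   : ∀ i j → vtx i ≡ vtx j → i ≡ j
    adjNext : ∀ (i : Fin (suc (suc len))) →
              Adj G (vtx (Data.Fin.inject₁ i)) (vtx (Data.Fin.suc i))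
    adjClose : Adj G (vtx (Data.Fin.fromℕ (suc (suc len)))) (vtx Data.Fin.zero)

IsTree : ∀ {n} → Graph n → Set
IsTree G = Connected G × ¬ Cycle G

ConnectedSet : ∀ {n} → Graph n → Subset n → Set
ConnectedSet G X = ∀ x y → x ∈ X → y ∈ X → ∃ λ k → Walk (AdjIn G X) x y k

record SteinerRoot4 {n : ℕ} (G : Graph n) : Set where
  field
    m      : ℕ
    T      : Graph m
    isTree : IsTree T
    ι      : Fin n → Fin m
    ι-inj  : ∀ u v → ι u ≡ ι v → u ≡ v
    root   : ∀ u v → u ≢ v → Adj G u v ⇔ DistLe (Adj T) 4 (ι u) (ι v)

MapsInto : ∀ {n m} → (Fin n → Fin m) → Subset n → Subset m → Set
MapsInto ι S X = ∀ v → v ∈ S → ι v ∈ X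

IsSteinerHull : ∀ {n m} → Graph m → (Fin n → Fin m) → Subset n → Subset m → Set
IsSteinerHull T ι S X =
  MapsInto ι S X × ConnectedSet T X ×
  (∀ Y → MapsInto ι S Y → ConnectedSet T Y → X ⊆ Y)

-- The subtree T[X] has diameter exactly 2 (non-edge star)
NonEdgeStar : ∀ {m} → Graph m → Subset m → Set
NonEdgeStar T X =
  (∀ x y → x ∈ X → y ∈ X → DistLe (AdjIn T X) 2 x y) ×
  (∃ λ x → ∃ λ y → x ∈ X × y ∈ X × ¬ DistLe (AdjIn T X) 1 x y)

AdjAvoid : ∀ {n} → Graph n → Subset n → Fin n → Fin n → Set
AdjAvoid G S x y = x ∉ S × y ∉ S × Adj G x y

Separates : ∀ {n} → Graph n → Fin n → Fin n → Subset n → Set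
Separates G a b S = a ∉ S × b ∉ S × ¬ (∃ λ k → Walk (AdjAvoid G S) a b k)

IsMinimalSeparator : ∀ {n} → Graph n → Subset n → Set
IsMinimalSeparator G S = ∃ λ a → ∃ λ b →
  Separates G a b S × (∀ S' → S' ⊂ S → ¬ Separates G a b S')

IsClique : ∀ {n} → Graph n → Subset n → Set
IsClique G K = ∀ x y → x ∈ K → y ∈ K → x ≢ y → Adj G x y

IsMaximalClique : ∀ {n} → Graph n → Subset n → Set
IsMaximalClique G K = IsClique G K × (∀ K' → IsClique G K' → K ⊆ K' → K' ⊆ K)

record CliqueTree {n : ℕ} (G : Graph n) : Set where
  field
    p        : ℕ
    𝒯        : Graph p
    isTree   : IsTree 𝒯
    clique   : Fin p → Subset n
    maximal  : ∀ i → IsMaximalClique G (clique i)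
    inj      : ∀ i j → clique i ≡ clique j → i ≡ j
    surj     : ∀ K → IsMaximalClique G K → ∃ λ i → clique i ≡ K
    subtree  : ∀ v → ∀ i j → v ∈ clique i → v ∈ clique j →
               ∃ λ k → Walk (λ a b → v ∈ clique a × v ∈ clique b × Adj 𝒯 a b) i j k

WeaklyConvergent : ∀ {n} {G : Graph n} → CliqueTree G → Subset n → Set
WeaklyConvergent CT S =
  ∃ λ i → ∀ j j' → Adj 𝒯 j j' → S ⊂ (clique j ∩ clique j') → (i ≡ j ⊎ i ≡ j')
  where open CliqueTree CT

module Submission where

-- Lemma 5.4.  Let the Steiner hull X = T⟨S⟩ of a minimal separator S be a
-- star with centre c.  Its leaves x₀, y₀ are images of terminals s₁, s₂ ∈ S
-- and lie in different branches of T - c.  Since S is minimal, the full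
-- components of a and b contain neighbours of s₁ and s₂, which forces every
-- w ∉ S to be mapped at distance ≥ 2 from c.  The vertices mapped within 2 of
-- c form a clique Inner; a maximal clique K* ⊇ Inner is a clique-tree node.
-- For an edge KK' with S ⊊ K ∩ K' there are non-adjacent k ∈ K, k' ∈ K', one
-- of them, say k, outside Inner; a branch argument in T - c then gives
-- K' ⊆ Inner, i.e. K' = K*.  So K* is an end of all such edges.

open import Defs
open import Data.Nat using (ℕ; zero; suc; _+_; _≤_; _≤?_; z≤n; s≤s)
open import Data.Nat.Properties using (≤-trans; ≰⇒>; +-mono-≤; +-monoʳ-≤; +-cancelʳ-≤; ≤-refl)
open import Data.Fin using (Fin; zero; suc; inject₁; fromℕ; _≟_)
open import Data.Fin.Properties using (any?; all?)
open import Data.Fin.Subset using (Subset; _∈_; _∉_; _⊆_; _⊂_; _∩_; _∪_; ⁅_⁆; _-_)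
open import Data.Fin.Subset.Properties
  using (_∈?_; ⊆-antisym; ⊆-trans; x∈p∩q⁻; x∈p∪q⁻; x∈p∪q⁺; x∈⁅x⁆; x∈⁅y⁆⇒x≡y;
         x∈p∧x≢y⇒x∈p-y; x∈p⇒p-x⊂p; p─q⊆p)
open import Data.Vec using (Vec; []; _∷_; lookup; tabulate; here; there)
open import Data.Vec.Properties using (lookup⇒[]=; []=⇒lookup; lookup∘tabulate)
open import Data.Vec.Membership.Propositional using () renaming (_∈_ to _∈ᵥ_)
open import Data.Vec.Membership.Propositional.Properties using (∈-lookup)
open import Data.Vec.Relation.Unary.Any using (here; there)
open import Data.List using (List; []; _∷_; allFin)
open import Data.List.Membership.Propositional using () renaming (_∈_ to _∈ₗ_)
open import Data.List.Membership.Propositional.Properties using (∈-allFin)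
import Data.List.Relation.Unary.Any as ListAny
open import Data.Product using (∃; ∃₂; _×_; _,_; proj₁; proj₂)
open import Data.Sum using (_⊎_; inj₁; inj₂; [_,_]′)
open import Data.Empty using (⊥-elim)
open import Data.Bool using (true)
import Data.Bool.Properties as Bool
open import Function using (_∘_)
open import Function.Bundles using (Equivalence)
open import Relation.Binary using (Symmetric)
open import Relation.Nullary using (¬_; Dec; yes; no; does)
open import Relation.Nullary.Decidable using (_×-dec_; _→-dec_; ¬?; dec-true)
open import Relation.Binary.PropositionalEquality
  using (_≡_; _≢_; refl; cong; subst; trans) renaming (sym to ≡-sym)

module _ {n : ℕ} {R : Fin n → Fin n → Set} where

  _++ʷ_ : ∀ {x y z i j} → Walk R x y i → Walk R y z j → Walk R x z (i + j)
  here ++ʷ q = q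
  step r p ++ʷ q = step r (p ++ʷ q)

  _▷_ : ∀ {x y z i} → Walk R x y i → R y z → Walk R x z (suc i)
  here ▷ r = step r here
  step r' p ▷ r = step r' (p ▷ r)

  reverseʷ : Symmetric R → ∀ {x y i} → Walk R x y i → Walk R y x i
  reverseʷ R-sym here = here
  reverseʷ R-sym (step r p) = reverseʷ R-sym p ▷ R-sym r

  unsnoc : ∀ {x y i} → Walk R x y (suc i) → ∃ λ z → Walk R x z i × R z y
  unsnoc (step r here) = _ , here , r
  unsnoc (step r (step r' p)) with unsnoc (step r' p)
  ... | z , q , r'' = z , step r q , r''

  dist-refl : ∀ {d x} → DistLe R d x x
  dist-refl = 0 , z≤n , here

  dist-trans : ∀ {d e x y z} → DistLe R d x y → DistLe R e y z → DistLe R (d + e) x z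
  dist-trans (i , i≤d , p) (j , j≤e , q) = i + j , +-mono-≤ i≤d j≤e , p ++ʷ q

  dist-sym : Symmetric R → ∀ {d x y} → DistLe R d x y → DistLe R d y x
  dist-sym R-sym (i , i≤d , p) = i , i≤d , reverseʷ R-sym p

  dist≤1 : ∀ {x y} → DistLe R 1 x y → x ≡ y ⊎ R x y
  dist≤1 (0 , _ , here) = inj₁ refl
  dist≤1 (1 , _ , step r here) = inj₂ r
  dist≤1 (suc (suc _) , s≤s () , _)

  long-walk : ∀ {d x y j} → ¬ DistLe R d x y → Walk R x y j → suc d ≤ j
  long-walk {d} {j = j} far p with j ≤? d
  ... | yes j≤d = ⊥-elim (far (j , j≤d , p))
  ... | no j≰d = ≰⇒> j≰d

mapʷ : ∀ {n} {R R' : Fin n → Fin n → Set} → (∀ {x y} → R x y → R' x y) →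
       ∀ {x y i} → Walk R x y i → Walk R' x y i
mapʷ f here = here
mapʷ f (step r p) = step (f r) (mapʷ f p)

distLe? : ∀ {n} {R : Fin n → Fin n → Set} → (∀ x y → Dec (R x y)) →
          ∀ d x y → Dec (DistLe R d x y)
distLe? R? zero x y with x ≟ y
... | yes refl = yes dist-refl
... | no x≢y = no λ { (0 , _ , here) → x≢y refl ; (suc _ , () , _) }
distLe? R? (suc d) x y with x ≟ y
... | yes refl = yes dist-refl
... | no x≢y with any? (λ z → R? x z ×-dec distLe? R? d z y)
...   | yes (z , r , j , j≤d , p) = yes (suc j , s≤s j≤d , step r p)
...   | no ¬via = no λ
  { (0 , _ , here) → x≢y refl
  ; (suc j , s≤s j≤d , step r p) → ¬via (_ , r , j , j≤d , p) }

adj-sym : ∀ {n} (G : Graph n) → Symmetric (Adj G)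
adj-sym G {x} {y} r = trans (≡-sym (sym G x y)) r

adj-irrefl : ∀ {n} (G : Graph n) {x y} → Adj G x y → x ≢ y
adj-irrefl G {x} r refl with trans (≡-sym r) (irrefl G x)
... | ()

adj? : ∀ {n} (G : Graph n) → ∀ x y → Dec (Adj G x y)
adj? G x y = edge G x y Bool.≟ true

Reach : ∀ {n} → Graph n → Subset n → Fin n → Fin n → Set
Reach G S x y = ∃ λ k → Walk (AdjAvoid G S) x y k

module Reachability {n : ℕ} (G : Graph n) (S : Subset n) where

  avoid-sym : Symmetric (AdjAvoid G S)
  avoid-sym (x∉S , y∉S , r) = y∉S , x∉S , adj-sym G r

  reach-sym : ∀ {x y} → Reach G S x y → Reach G S y x
  reach-sym (k , p) = k , reverseʷ avoid-sym p

  separates-sym : ∀ {a b} → Separates G a b S → Separates G b a S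
  separates-sym (a∉S , b∉S , ¬ab) = b∉S , a∉S , ¬ab ∘ reach-sym

  reach-trans : ∀ {x y z} → Reach G S x y → Reach G S y z → Reach G S x z
  reach-trans (k , p) (l , q) = k + l , p ++ʷ q

  reach-closed-nbhd : ∀ {x y} → x ∉ S → y ∉ S → x ≡ y ⊎ Adj G x y → Reach G S x y
  reach-closed-nbhd x∉S y∉S (inj₁ refl) = 0 , here
  reach-closed-nbhd x∉S y∉S (inj₂ r) = 1 , step (x∉S , y∉S , r) here

-- Walks without repeated vertices.  Every walk shortens to one (by cutting out
-- the closed detours); their vertex sequences are injective, which is what is
-- needed to exhibit a cycle.
module SimplePaths {n : ℕ} (R : Fin n → Fin n → Set) where
  open import Data.Vec.Membership.DecPropositional (_≟_ {n}) using () renaming (_∈?_ to _∈ᵥ?_)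

  mutual
    data Path : Fin n → Fin n → ℕ → Set where
      nil  : ∀ {x} → Path x x 0
      cons : ∀ {x y z k} → R x y → (p : Path y z k) → ¬ (x ∈ᵥ vertices p) → Path x z (suc k)

    vertices : ∀ {x z k} → Path x z k → Vec (Fin n) (suc k)
    vertices {x} nil = x ∷ []
    vertices {x} (cons r p fresh) = x ∷ vertices p

  suffix : ∀ {x y z k} (p : Path y z k) → x ∈ᵥ vertices p → ∃ λ k' → Path x z k'
  suffix nil (here refl) = _ , nil
  suffix (cons r p fresh) (here refl) = _ , cons r p fresh
  suffix (cons r p fresh) (there x∈p) = suffix p x∈p

  shorten : ∀ {x z k} → Walk R x z k → ∃ λ k' → Path x z k'
  shorten here = _ , nil
  shorten (step {x} r w) with shorten w
  ... | _ , p with x ∈ᵥ? vertices p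
  ...   | yes x∈p = suffix p x∈p
  ...   | no fresh = _ , cons r p fresh

  first-vertex : ∀ {x z k} (p : Path x z k) → lookup (vertices p) zero ≡ x
  first-vertex nil = refl
  first-vertex (cons r p fresh) = refl

  last-vertex : ∀ {x z k} (p : Path x z k) → lookup (vertices p) (fromℕ k) ≡ z
  last-vertex nil = refl
  last-vertex (cons r p fresh) = last-vertex p

  consecutive : ∀ {x z k} (p : Path x z k) (i : Fin k) →
                R (lookup (vertices p) (inject₁ i)) (lookup (vertices p) (suc i))
  consecutive (cons r p fresh) zero rewrite first-vertex p = r
  consecutive (cons r p fresh) (suc i) = consecutive p i

  vertices-injective : ∀ {x z k} (p : Path x z k) i j →
                       lookup (vertices p) i ≡ lookup (vertices p) j → i ≡ j
  vertices-injective nil zero zero _ = refl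
  vertices-injective (cons r p fresh) zero zero _ = refl
  vertices-injective (cons r p fresh) zero (suc j) e =
    ⊥-elim (fresh (subst (_∈ᵥ vertices p) (≡-sym e) (∈-lookup j (vertices p))))
  vertices-injective (cons r p fresh) (suc i) zero e =
    ⊥-elim (fresh (subst (_∈ᵥ vertices p) e (∈-lookup i (vertices p))))
  vertices-injective (cons r p fresh) (suc i) (suc j) e = cong suc (vertices-injective p i j e)

module Branches {m : ℕ} (T : Graph m) (acyclic : ¬ Cycle T) (c : Fin m) where

  EdgeOff : Fin m → Fin m → Set
  EdgeOff x y = x ≢ c × y ≢ c × Adj T x y

  SameBranch : Fin m → Fin m → Set
  SameBranch x y = ∃ λ k → Walk EdgeOff x y k

  branch-refl : ∀ {x} → SameBranch x x
  branch-refl = 0 , here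

  branch-sym : ∀ {x y} → SameBranch x y → SameBranch y x
  branch-sym (k , p) = k , reverseʷ (λ (x≢c , y≢c , r) → y≢c , x≢c , adj-sym T r) p

  branch-trans : ∀ {x y z} → SameBranch x y → SameBranch y z → SameBranch x z
  branch-trans (k , p) (l , q) = k + l , p ++ʷ q

  far⇒≢c : ∀ {d t} → ¬ DistLe (Adj T) d t c → t ≢ c
  far⇒≢c far refl = far dist-refl

  ≢c⇒far : ∀ {t} → t ≢ c → ¬ DistLe (Adj T) 0 t c
  ≢c⇒far t≢c (0 , _ , here) = t≢c refl

  split : ∀ {x t k} → Walk (Adj T) x t k →
          Walk EdgeOff x t k ⊎ (∃₂ λ i j → i + j ≡ k × Walk (Adj T) x c i × Walk (Adj T) c t j)
  split here = inj₁ here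
  split {x} (step {y = y} r p) with x ≟ c | y ≟ c
  ... | yes refl | _ = inj₂ (0 , _ , refl , here , step r p)
  ... | no _ | yes refl = inj₂ (1 , _ , refl , step r here , p)
  ... | no x≢c | no y≢c with split p
  ...   | inj₁ q = inj₁ (step (x≢c , y≢c , r) q)
  ...   | inj₂ (i , j , e , p₁ , p₂) = inj₂ (suc i , j , cong suc e , step r p₁ , p₂)

  branch-or-near : ∀ d e {x t} → ¬ DistLe (Adj T) e t c →
                   DistLe (Adj T) (d + suc e) x t → SameBranch x t ⊎ DistLe (Adj T) d x c
  branch-or-near d e far (k , k≤ , p) with split p
  ... | inj₁ q = inj₁ (k , q)
  ... | inj₂ (i , j , refl , p₁ , p₂) = inj₂ (i , i≤d , p₁)
    where
      e<j : suc e ≤ j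
      e<j = long-walk far (reverseʷ (adj-sym T) p₂)
      i≤d : i ≤ d
      i≤d = +-cancelʳ-≤ (suc e) i d (≤-trans (+-monoʳ-≤ i e<j) k≤)

  module P = SimplePaths EdgeOff

  path-avoids-c : ∀ {x z k} (p : P.Path x z k) → z ≢ c → ∀ i → lookup (P.vertices p) i ≢ c
  path-avoids-c P.nil z≢c zero = z≢c
  path-avoids-c (P.cons r p _) z≢c zero = proj₁ r
  path-avoids-c (P.cons r p _) z≢c (suc i) = path-avoids-c p z≢c i

  -- Distinct neighbours of c lie in different branches: a path between them
  -- in T - c, closed up through c, would be a cycle of T.
  neighbours-separated : ∀ {a b} → a ≢ b → Adj T a c → Adj T b c → ¬ SameBranch a b
  neighbours-separated a≢b ac bc (_ , w) with P.shorten w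
  ... | _ , P.nil = a≢b refl
  ... | suc k , path@(P.cons r p _) = acyclic cycle
    where
      vtx : Fin (suc (suc (suc k))) → Fin m
      vtx zero = c
      vtx (suc i) = lookup (P.vertices path) i
      vtx-injective : ∀ i j → vtx i ≡ vtx j → i ≡ j
      vtx-injective zero zero _ = refl
      vtx-injective zero (suc j) e = ⊥-elim (path-avoids-c path (adj-irrefl T bc) j (≡-sym e))
      vtx-injective (suc i) zero e = ⊥-elim (path-avoids-c path (adj-irrefl T bc) i e)
      vtx-injective (suc i) (suc j) e = cong suc (P.vertices-injective path i j e)
      vtx-next : ∀ (i : Fin (suc (suc k))) → Adj T (vtx (inject₁ i)) (vtx (suc i))
      vtx-next zero = adj-sym T ac
      vtx-next (suc i) = proj₂ (proj₂ (P.consecutive path i))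
      vtx-close : Adj T (vtx (fromℕ (suc (suc k)))) (vtx zero)
      vtx-close rewrite P.last-vertex path = bc
      cycle : Cycle T
      cycle = record { len = k ; vtx = vtx ; inj = vtx-injective
                     ; adjNext = vtx-next ; adjClose = vtx-close }

  branch-root : ∀ {t} → ¬ DistLe (Adj T) 1 t c → DistLe (Adj T) 3 t c →
                ∃ λ b → Adj T b c × DistLe (Adj T) 2 t b × SameBranch t b
  branch-root far (0 , _ , here) = ⊥-elim (far dist-refl)
  branch-root far (suc j , s≤s j≤2 , p) with unsnoc p
  ... | b , q , bc with branch-or-near 1 0 (≢c⇒far (adj-irrefl T bc)) (j , j≤2 , q)
  ...   | inj₁ same = b , bc , (j , j≤2 , q) , same
  ...   | inj₂ near = ⊥-elim (far near)

  same-branch-close : ∀ {u v} → ¬ DistLe (Adj T) 1 u c → DistLe (Adj T) 3 u c →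
                      ¬ DistLe (Adj T) 1 v c → DistLe (Adj T) 3 v c →
                      SameBranch u v → DistLe (Adj T) 4 u v
  same-branch-close u-far u-near v-far v-near u~v
    with branch-root u-far u-near | branch-root v-far v-near
  ... | b , bc , u-b , u~b | b' , b'c , v-b' , v~b' with b ≟ b'
  ...   | yes refl = dist-trans u-b (dist-sym (adj-sym T) v-b')
  ...   | no b≢b' = ⊥-elim (neighbours-separated b≢b' bc b'c
                      (branch-trans (branch-sym u~b) (branch-trans u~v v~b')))

⟦_⟧ : ∀ {n} {P : Fin n → Set} → (∀ x → Dec (P x)) → Subset n
⟦ P? ⟧ = tabulate (λ x → does (P? x))

module _ {n : ℕ} {P : Fin n → Set} (P? : ∀ x → Dec (P x)) where

  ∈⟦⟧⁺ : ∀ {x} → P x → x ∈ ⟦ P? ⟧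
  ∈⟦⟧⁺ {x} px = lookup⇒[]= x _ (trans (lookup∘tabulate _ x) (dec-true (P? x) px))

  ∈⟦⟧⁻ : ∀ {x} → x ∈ ⟦ P? ⟧ → P x
  ∈⟦⟧⁻ {x} x∈ = holds (P? x) (trans (≡-sym (lookup∘tabulate _ x)) ([]=⇒lookup x∈))
    where
      holds : (d : Dec (P x)) → does d ≡ true → P x
      holds (yes px) _ = px

x∉p-x : ∀ {n} {p : Subset n} {x} → x ∉ p - x
x∉p-x {p = _ ∷ p} {zero} ()
x∉p-x {p = _ ∷ p} {suc x} (there x∈) = x∉p-x {p = p} x∈

-- Every clique of G lies in a maximal one: greedily add each vertex that is
-- adjacent to all vertices chosen so far.
module MaximalCliques {n : ℕ} (G : Graph n) where

  CanAdd : Subset n → Fin n → Set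
  CanAdd Q v = ∀ u → u ∈ Q → u ≢ v → Adj G u v

  canAdd? : ∀ Q v → Dec (CanAdd Q v)
  canAdd? Q v = all? (λ u → (u ∈? Q) →-dec (¬? (u ≟ v)) →-dec adj? G u v)

  grow : Subset n → List (Fin n) → Subset n
  grow Q [] = Q
  grow Q (v ∷ vs) with canAdd? Q v
  ... | yes _ = grow (Q ∪ ⁅ v ⁆) vs
  ... | no _ = grow Q vs

  grow-⊇ : ∀ Q vs → Q ⊆ grow Q vs
  grow-⊇ Q [] x∈ = x∈
  grow-⊇ Q (v ∷ vs) x∈ with canAdd? Q v
  ... | yes _ = grow-⊇ (Q ∪ ⁅ v ⁆) vs (x∈p∪q⁺ (inj₁ x∈))
  ... | no _ = grow-⊇ Q vs x∈

  add-clique : ∀ Q v → IsClique G Q → CanAdd Q v → IsClique G (Q ∪ ⁅ v ⁆)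
  add-clique Q v Q-clique v-ok x y x∈ y∈ x≢y with x∈p∪q⁻ Q ⁅ v ⁆ x∈ | x∈p∪q⁻ Q ⁅ v ⁆ y∈
  ... | inj₁ x∈Q | inj₁ y∈Q = Q-clique x y x∈Q y∈Q x≢y
  ... | inj₁ x∈Q | inj₂ y∈v rewrite x∈⁅y⁆⇒x≡y v y∈v = v-ok x x∈Q x≢y
  ... | inj₂ x∈v | inj₁ y∈Q rewrite x∈⁅y⁆⇒x≡y v x∈v = adj-sym G (v-ok y y∈Q (x≢y ∘ ≡-sym))
  ... | inj₂ x∈v | inj₂ y∈v = ⊥-elim (x≢y (trans (x∈⁅y⁆⇒x≡y v x∈v) (≡-sym (x∈⁅y⁆⇒x≡y v y∈v))))

  grow-clique : ∀ Q vs → IsClique G Q → IsClique G (grow Q vs)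
  grow-clique Q [] Q-clique = Q-clique
  grow-clique Q (v ∷ vs) Q-clique with canAdd? Q v
  ... | yes v-ok = grow-clique (Q ∪ ⁅ v ⁆) vs (add-clique Q v Q-clique v-ok)
  ... | no _ = grow-clique Q vs Q-clique

  grow-saturated : ∀ Q vs v → v ∈ₗ vs → CanAdd (grow Q vs) v → v ∈ grow Q vs
  grow-saturated Q (v' ∷ vs) v (ListAny.here refl) v-ok with canAdd? Q v'
  ... | yes _ = grow-⊇ (Q ∪ ⁅ v' ⁆) vs (x∈p∪q⁺ (inj₂ (x∈⁅x⁆ v')))
  ... | no ¬ok = ⊥-elim (¬ok (λ u u∈Q u≢v → v-ok u (grow-⊇ Q vs u∈Q) u≢v))
  grow-saturated Q (v' ∷ vs) v (ListAny.there v∈vs) v-ok with canAdd? Q v'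
  ... | yes _ = grow-saturated (Q ∪ ⁅ v' ⁆) vs v v∈vs v-ok
  ... | no _ = grow-saturated Q vs v v∈vs v-ok

  extend-to-maximal : ∀ Q → IsClique G Q → ∃ λ K → IsMaximalClique G K × Q ⊆ K
  extend-to-maximal Q Q-clique = K , (grow-clique Q (allFin n) Q-clique , maximal) , grow-⊇ Q (allFin n)
    where
      K : Subset n
      K = grow Q (allFin n)
      maximal : ∀ K' → IsClique G K' → K ⊆ K' → K' ⊆ K
      maximal K' K'-clique K⊆K' {x} x∈K' =
        grow-saturated Q (allFin n) x (∈-allFin x)
          (λ u u∈K u≢x → K'-clique u x (K⊆K' u∈K) x∈K' u≢x)

  maximal-⊆ : ∀ {K K'} → IsMaximalClique G K → IsMaximalClique G K' → K' ⊆ K → K' ≡ K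
  maximal-⊆ (K-clique , _) (_ , K'-maximal) K'⊆K = ⊆-antisym K'⊆K (K'-maximal _ K-clique K'⊆K)

  -- Distinct maximal cliques contain distinct non-adjacent vertices, one in
  -- each: otherwise their union would be a clique.
  non-adjacent-pair : ∀ {K K'} → IsMaximalClique G K → IsMaximalClique G K' → K ≢ K' →
                      ∃₂ λ k k' → k ∈ K × k' ∈ K' × k ≢ k' × ¬ Adj G k k'
  non-adjacent-pair {K} {K'} K-max K'-max K≢K'
    with any? (λ k → any? (λ k' → (k ∈? K) ×-dec (k' ∈? K') ×-dec ¬? (k ≟ k') ×-dec ¬? (adj? G k k')))
  ... | yes (k , k' , found) = k , k' , found
  ... | no none = ⊥-elim (K≢K' (≡-sym (maximal-⊆ K-max K'-max K'⊆K)))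
    where
      across : ∀ x y → x ∈ K → y ∈ K' → x ≢ y → Adj G x y
      across x y x∈ y∈ x≢y with adj? G x y
      ... | yes r = r
      ... | no ¬r = ⊥-elim (none (x , y , x∈ , y∈ , x≢y , ¬r))
      union-clique : IsClique G (K ∪ K')
      union-clique x y x∈ y∈ x≢y with x∈p∪q⁻ K K' x∈ | x∈p∪q⁻ K K' y∈
      ... | inj₁ x∈K | inj₁ y∈K = proj₁ K-max x y x∈K y∈K x≢y
      ... | inj₂ x∈K' | inj₂ y∈K' = proj₁ K'-max x y x∈K' y∈K' x≢y
      ... | inj₁ x∈K | inj₂ y∈K' = across x y x∈K y∈K' x≢y
      ... | inj₂ x∈K' | inj₁ y∈K = adj-sym G (across y x y∈K x∈K' (x≢y ∘ ≡-sym))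
      K'⊆K : K' ⊆ K
      K'⊆K x∈K' = proj₂ K-max (K ∪ K') union-clique (x∈p∪q⁺ ∘ inj₁) (x∈p∪q⁺ (inj₂ x∈K'))

-- A vertex of the Steiner hull X of S whose removal leaves X connected is the
-- image of a vertex of S; otherwise X - x would be a smaller connected set
-- containing ι[S].
hull-leaf-is-terminal : ∀ {n m} {T : Graph m} {ι : Fin n → Fin m} {S : Subset n} {X : Subset m} →
                        IsSteinerHull T ι S X → ∀ {x} → x ∈ X → ConnectedSet T (X - x) →
                        ∃ λ s → s ∈ S × ι s ≡ x
hull-leaf-is-terminal {ι = ι} {S} {X} (maps , _ , least) {x} x∈X connected
  with any? (λ s → (s ∈? S) ×-dec (ι s ≟ x))
... | yes terminal = terminal
... | no none = ⊥-elim (x∉p-x {p = X} (least (X - x) maps-into connected x∈X))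
  where
    maps-into : MapsInto ι S (X - x)
    maps-into s s∈S = x∈p∧x≢y⇒x∈p-y (maps s s∈S) (λ ιs≡x → none (s , s∈S , ιs≡x))

star-connected : ∀ {m} (T : Graph m) (Y : Subset m) (c : Fin m) → c ∈ Y →
                 (∀ t → t ∈ Y → t ≡ c ⊎ Adj T t c) → ConnectedSet T Y
star-connected T Y c c∈Y spoke x y x∈Y y∈Y =
  _ , proj₂ (to-centre x∈Y) ++ʷ reverseʷ (λ (a∈ , b∈ , r) → b∈ , a∈ , adj-sym T r) (proj₂ (to-centre y∈Y))
  where
    to-centre : ∀ {t} → t ∈ Y → ∃ λ k → Walk (AdjIn T Y) t c k
    to-centre {t} t∈Y with spoke t t∈Y
    ... | inj₁ refl = 0 , here
    ... | inj₂ r = 1 , step (t∈Y , c∈Y , r) here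

record Star {m : ℕ} (T : Graph m) (X : Subset m) : Set where
  field
    centre    : Fin m
    centre∈X  : centre ∈ X
    spoke     : ∀ t → t ∈ X → t ≡ centre ⊎ Adj T t centre
    leaf₁     : Fin m
    leaf₂     : Fin m
    leaf₁∈X   : leaf₁ ∈ X
    leaf₂∈X   : leaf₂ ∈ X
    leaf₁-adj : Adj T leaf₁ centre
    leaf₂-adj : Adj T leaf₂ centre
    leaves-distinct : leaf₁ ≢ leaf₂

-- In an acyclic graph, a set of diameter exactly 2 is a star around the
-- middle vertex c of a diametral pair x, y: a vertex of X farther from c
-- would lie in the branches of both x and y at c.
non-edge-star-shape : ∀ {m} (T : Graph m) → ¬ Cycle T → ∀ X → NonEdgeStar T X → Star T X
non-edge-star-shape T acyclic X (diam≤2 , x , y , x∈X , y∈X , x≁y)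
  with diam≤2 x y x∈X y∈X
... | 0 , _ , here = ⊥-elim (x≁y dist-refl)
... | 1 , _ , p = ⊥-elim (x≁y (1 , ≤-refl , p))
... | suc (suc (suc _)) , s≤s (s≤s ()) , _
... | 2 , _ , step {y = c} (_ , c∈X , xc) (step (_ , _ , cy) here) = record
  { centre = c ; centre∈X = c∈X ; spoke = spoke
  ; leaf₁ = x ; leaf₂ = y ; leaf₁∈X = x∈X ; leaf₂∈X = y∈X
  ; leaf₁-adj = xc ; leaf₂-adj = yc ; leaves-distinct = x≢y }
  where
    open Branches T acyclic c
    yc : Adj T y c
    yc = adj-sym T cy
    x≢y : x ≢ y
    x≢y refl = x≁y dist-refl
    in-T : ∀ {t u} → DistLe (AdjIn T X) 2 t u → DistLe (Adj T) 2 t u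
    in-T (k , k≤ , p) = k , k≤ , mapʷ (proj₂ ∘ proj₂) p
    spoke : ∀ t → t ∈ X → t ≡ c ⊎ Adj T t c
    spoke t t∈X with branch-or-near 1 0 (≢c⇒far (adj-irrefl T xc)) (in-T (diam≤2 t x t∈X x∈X))
                   | branch-or-near 1 0 (≢c⇒far (adj-irrefl T yc)) (in-T (diam≤2 t y t∈X y∈X))
    ... | inj₂ near | _ = dist≤1 near
    ... | inj₁ _ | inj₂ near = dist≤1 near
    ... | inj₁ t~x | inj₁ t~y =
      ⊥-elim (neighbours-separated x≢y xc yc (branch-trans (branch-sym t~x) t~y))

module Separators {n : ℕ} (G : Graph n) (S : Subset n) where
  open Reachability G S

  exit-before : ∀ s {x y k} → Walk (AdjAvoid G (S - s)) x y k → x ∉ S →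
                Reach G S x y ⊎ (∃ λ u → Reach G S x u × u ∉ S × Adj G u s)
  exit-before s here x∉S = inj₁ (0 , here)
  exit-before s {x} (step {y = z} (_ , z∉S-s , r) p) x∉S with z ∈? S
  ... | yes z∈S = inj₂ (x , (0 , here) , x∉S , subst (Adj G x) z≡s r)
    where
      z≡s : z ≡ s
      z≡s with z ≟ s
      ... | yes e = e
      ... | no z≢s = ⊥-elim (z∉S-s (x∈p∧x≢y⇒x∈p-y z∈S z≢s))
  ... | no z∉S with exit-before s p z∉S
  ...   | inj₁ (_ , q) = inj₁ (_ , step (x∉S , z∉S , r) q)
  ...   | inj₂ (u , (_ , q) , u∉S , us) = inj₂ (u , (_ , step (x∉S , z∉S , r) q) , u∉S , us)

  -- Every vertex s of a minimal (a,b)-separator has a neighbour in the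
  -- component of a in G - S (constructively: this cannot fail).
  full-component : ∀ {a b s} → Separates G a b S → (∀ S' → S' ⊂ S → ¬ Separates G a b S') →
                   s ∈ S → ¬ ¬ (∃ λ u → Reach G S a u × u ∉ S × Adj G u s)
  full-component {a} {b} {s} (a∉S , b∉S , ¬ab) minimal s∈S none =
    minimal (S - s) (x∈p⇒p-x⊂p s∈S)
      (a∉S ∘ p─q⊆p S ⁅ s ⁆ , b∉S ∘ p─q⊆p S ⁅ s ⁆ ,
       λ (_ , p) → [ ¬ab , none ]′ (exit-before s p a∉S))

∉⇒≢ : ∀ {n} {S : Subset n} {u s} → u ∉ S → s ∈ S → u ≢ s
∉⇒≢ u∉S s∈S refl = u∉S s∈S

module StarHull {n : ℕ} (G : Graph n) (R : SteinerRoot4 G) (S : Subset n) {a b : Fin n}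
  (separates : Separates G a b S) (minimal : ∀ S' → S' ⊂ S → ¬ Separates G a b S')
  (X : Subset (SteinerRoot4.m R)) (hull : IsSteinerHull (SteinerRoot4.T R) (SteinerRoot4.ι R) S X)
  (star : Star (SteinerRoot4.T R) X) where

  open SteinerRoot4 R using (T; ι; root) renaming (isTree to T-tree)
  open Star star renaming (centre to c; leaf₁ to x₀; leaf₂ to y₀)
  open Branches T (proj₂ T-tree) c
  open Reachability G S
  open Separators G S
  open MaximalCliques G

  adj⇒close : ∀ {u v} → u ≢ v → Adj G u v → DistLe (Adj T) 4 (ι u) (ι v)
  adj⇒close {u} {v} u≢v = Equivalence.to (root u v u≢v)

  close⇒adj : ∀ {u v} → u ≢ v → DistLe (Adj T) 4 (ι u) (ι v) → Adj G u v
  close⇒adj {u} {v} u≢v = Equivalence.from (root u v u≢v)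

  clique-close : ∀ {K u v} → IsClique G K → u ∈ K → v ∈ K → DistLe (Adj T) 4 (ι u) (ι v)
  clique-close {u = u} {v} K-clique u∈K v∈K with u ≟ v
  ... | yes refl = dist-refl
  ... | no u≢v = adj⇒close u≢v (K-clique u v u∈K v∈K u≢v)

  leaves-separated : ¬ SameBranch x₀ y₀
  leaves-separated = neighbours-separated leaves-distinct leaf₁-adj leaf₂-adj

  -- A neighbour x of c in X is the image of a terminal, as X - x is still a
  -- star around c.
  leaf-terminal : ∀ {x} → x ∈ X → Adj T x c → ∃ λ s → s ∈ S × ι s ≡ x
  leaf-terminal {x} x∈X xc = hull-leaf-is-terminal {T = T} hull x∈X
    (star-connected T (X - x) c (x∈p∧x≢y⇒x∈p-y centre∈X (adj-irrefl T xc ∘ ≡-sym))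
      (λ t t∈ → spoke t (p─q⊆p X ⁅ x ⁆ t∈)))

  terminal₁ : ∃ λ s → s ∈ S × ι s ≡ x₀
  terminal₁ = leaf-terminal leaf₁∈X leaf₁-adj

  terminal₂ : ∃ λ s → s ∈ S × ι s ≡ y₀
  terminal₂ = leaf-terminal leaf₂∈X leaf₂-adj

  s₁ s₂ : Fin n
  s₁ = proj₁ terminal₁
  s₂ = proj₁ terminal₂

  s₁∈S : s₁ ∈ S
  s₁∈S = proj₁ (proj₂ terminal₁)

  s₂∈S : s₂ ∈ S
  s₂∈S = proj₁ (proj₂ terminal₂)

  ιs₁≡x₀ : ι s₁ ≡ x₀
  ιs₁≡x₀ = proj₂ (proj₂ terminal₁)

  ιs₂≡y₀ : ι s₂ ≡ y₀
  ιs₂≡y₀ = proj₂ (proj₂ terminal₂)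

  towards : ∀ {u s x} → ι s ≡ x → Adj G u s → DistLe (Adj T) 4 (ι u) x
  towards {u} refl us = adj⇒close (adj-irrefl G us) us

  -- A vertex adjacent to both s₁ and s₂ is mapped within 3 of c, since a
  -- walk of length ≤ 4 cannot reach both x₀ and y₀ inside one branch.
  common-neighbour-near : ∀ {u} → Adj G u s₁ → Adj G u s₂ → DistLe (Adj T) 3 (ι u) c
  common-neighbour-near us₁ us₂
    with branch-or-near 3 0 (≢c⇒far (adj-irrefl T leaf₁-adj)) (towards ιs₁≡x₀ us₁)
       | branch-or-near 3 0 (≢c⇒far (adj-irrefl T leaf₂-adj)) (towards ιs₂≡y₀ us₂)
  ... | inj₂ near | _ = near
  ... | inj₁ _ | inj₂ near = near
  ... | inj₁ u~x₀ | inj₁ u~y₀ = ⊥-elim (leaves-separated (branch-trans (branch-sym u~x₀) u~y₀))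

  Far : Fin n → Set
  Far x = ¬ DistLe (Adj T) 3 (ι x) c

  far-joins : ∀ {x t} → Far x → DistLe (Adj T) 4 (ι x) t → t ≢ c → SameBranch (ι x) t
  far-joins far close t≢c with branch-or-near 3 0 (≢c⇒far t≢c) close
  ... | inj₁ same = same
  ... | inj₂ near = ⊥-elim (far near)

  terminal-branch : ∀ {u s x} → ι s ≡ x → Adj T x c → Far u → Adj G u s → SameBranch (ι u) x
  terminal-branch ιs≡x xc far us = far-joins far (towards ιs≡x us) (adj-irrefl T xc)

  module NearCentre {w : Fin n} (w∉S : w ∉ S) (w-near : DistLe (Adj T) 1 (ι w) c) where

    -- vertices mapped within 3 of c are mapped within 4 of w
    far-unless-adjacent : ∀ {x} → x ≢ w → ¬ Adj G x w → Far x
    far-unless-adjacent x≢w x≁w near = x≁w (close⇒adj x≢w (dist-trans near (dist-sym (adj-sym T) w-near)))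

    -- A walk of G - S either meets the closed neighbourhood of w, or runs
    -- through far vertices and hence stays in one branch.
    reaches-w-or-stays : ∀ {x y k} → Walk (AdjAvoid G S) x y k → x ∉ S →
                         Reach G S x w ⊎ (SameBranch (ι x) (ι y) × Far x × Far y)
    reaches-w-or-stays {x} p x∉S with x ≟ w | adj? G x w
    ... | yes refl | _ = inj₁ (0 , here)
    ... | no _ | yes xw = inj₁ (reach-closed-nbhd x∉S w∉S (inj₂ xw))
    ... | no x≢w | no x≁w = stays p (far-unless-adjacent x≢w x≁w)
      where
        stays : ∀ {y k} → Walk (AdjAvoid G S) x y k → Far x →
                Reach G S x w ⊎ (SameBranch (ι x) (ι y) × Far x × Far y)
        stays here far-x = inj₂ (branch-refl , far-x , far-x)
        stays (step xz@(_ , z∉S , r) q) far-x with reaches-w-or-stays q z∉S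
        ... | inj₁ z⇝w = inj₁ (reach-trans (1 , step xz here) z⇝w)
        ... | inj₂ (z~y , far-z , far-y) =
          inj₂ (branch-trans (far-joins far-x (adj⇒close (adj-irrefl G r) r) (far⇒≢c far-z)) z~y
               , far-x , far-y)

    -- A vertex reaching neighbours of both s₁ and s₂ in G - S reaches w:
    -- otherwise x₀ and y₀ would lie in one branch.
    reaches-w : ∀ {v u₁ u₂} → Reach G S v u₁ → Reach G S v u₂ → u₁ ∉ S →
                Adj G u₁ s₁ → Adj G u₂ s₂ → Reach G S v w
    reaches-w v⇝u₁ v⇝u₂ u₁∉S u₁s₁ u₂s₂
      with reaches-w-or-stays (proj₂ (reach-trans (reach-sym v⇝u₁) v⇝u₂)) u₁∉S
    ... | inj₁ u₁⇝w = reach-trans v⇝u₁ u₁⇝w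
    ... | inj₂ (u₁~u₂ , far₁ , far₂) = ⊥-elim (leaves-separated
          (branch-trans (branch-sym (terminal-branch ιs₁≡x₀ leaf₁-adj far₁ u₁s₁))
            (branch-trans u₁~u₂ (terminal-branch ιs₂≡y₀ leaf₂-adj far₂ u₂s₂))))

  -- Every vertex w outside S is mapped at distance ≥ 2 from c: otherwise the
  -- full components of a and b would both contain w.
  outside-far : ∀ {w} → w ∉ S → ¬ DistLe (Adj T) 1 (ι w) c
  outside-far w∉S w-near =
    full-component separates minimal s₁∈S λ (a₁ , a⇝a₁ , a₁∉S , a₁s₁) →
    full-component separates minimal s₂∈S λ (a₂ , a⇝a₂ , _ , a₂s₂) →
    full-component separates′ minimal′ s₁∈S λ (b₁ , b⇝b₁ , b₁∉S , b₁s₁) →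
    full-component separates′ minimal′ s₂∈S λ (b₂ , b⇝b₂ , _ , b₂s₂) →
    proj₂ (proj₂ separates) (reach-trans (reaches-w a⇝a₁ a⇝a₂ a₁∉S a₁s₁ a₂s₂)
                                         (reach-sym (reaches-w b⇝b₁ b⇝b₂ b₁∉S b₁s₁ b₂s₂)))
    where
      open NearCentre w∉S w-near
      separates′ : Separates G b a S
      separates′ = separates-sym separates
      minimal′ : ∀ S' → S' ⊂ S → ¬ Separates G b a S'
      minimal′ S' S'⊂S = minimal S' S'⊂S ∘ Reachability.separates-sym G S'

  inner? : ∀ v → Dec (DistLe (Adj T) 2 (ι v) c)
  inner? v = distLe? (adj? T) 2 (ι v) c

  Inner : Subset n
  Inner = ⟦ inner? ⟧

  -- their images are pairwise within 4, so they form a clique of G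
  inner-clique : IsClique G Inner
  inner-clique u v u∈ v∈ u≢v =
    close⇒adj u≢v (dist-trans (∈⟦⟧⁻ inner? u∈) (dist-sym (adj-sym T) (∈⟦⟧⁻ inner? v∈)))

  -- a vertex outside S of a clique K ⊇ S is adjacent to s₁ and s₂, hence
  -- mapped within 3 of c
  clique-vertex-near : ∀ {K k} → IsClique G K → S ⊆ K → k ∈ K → k ∉ S → DistLe (Adj T) 3 (ι k) c
  clique-vertex-near K-clique S⊆K k∈K k∉S = common-neighbour-near
    (K-clique _ s₁ k∈K (S⊆K s₁∈S) (∉⇒≢ k∉S s₁∈S)) (K-clique _ s₂ k∈K (S⊆K s₂∈S) (∉⇒≢ k∉S s₂∈S))

  joins-outside : ∀ {u v} → ¬ DistLe (Adj T) 2 (ι u) c → v ∉ S →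
                  DistLe (Adj T) 4 (ι u) (ι v) → SameBranch (ι u) (ι v)
  joins-outside u-far v∉S close with branch-or-near 2 1 (outside-far v∉S) close
  ... | inj₁ same = same
  ... | inj₂ near = ⊥-elim (u-far near)

  -- Let cliques K, K' ⊇ S share a vertex w ∉ S, and let k ∈ K, k' ∈ K' be
  -- distinct and non-adjacent with k mapped farther than 2 from c.  Then
  -- K' ⊆ Inner: a vertex u ∈ K' outside Inner would put k and k' into one
  -- branch (through w and u), at distance 2 or 3 from c, hence adjacent.
  far-pair-forces-inner : ∀ {K K' w k k'} → IsClique G K → IsClique G K' → S ⊆ K → S ⊆ K' →
                          w ∈ K → w ∈ K' → w ∉ S → k ∈ K → k' ∈ K' → k ≢ k' → ¬ Adj G k k' →
                          ¬ DistLe (Adj T) 2 (ι k) c → K' ⊆ Inner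
  far-pair-forces-inner {K} {K'} {w} {k} {k'} K-clique K'-clique S⊆K S⊆K' w∈K w∈K' w∉S
                        k∈K k'∈K' k≢k' k≁k' k-far {u} u∈K' with inner? u
  ... | yes u-near = ∈⟦⟧⁺ inner? u-near
  ... | no u-far = ⊥-elim (k≁k' (close⇒adj k≢k'
          (same-branch-close (outside-far k∉S) (clique-vertex-near K-clique S⊆K k∈K k∉S)
                             (outside-far k'∉S) (clique-vertex-near K'-clique S⊆K' k'∈K' k'∉S) k~k')))
    where
      k∉S : k ∉ S
      k∉S k∈S = k≁k' (K'-clique k k' (S⊆K' k∈S) k'∈K' k≢k')
      k'∉S : k' ∉ S
      k'∉S k'∈S = k≁k' (K-clique k k' k∈K (S⊆K k'∈S) k≢k')
      k~k' : SameBranch (ι k) (ι k')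
      k~k' = branch-trans (joins-outside k-far w∉S (clique-close K-clique k∈K w∈K))
               (branch-trans (branch-sym (joins-outside u-far w∉S (clique-close K'-clique u∈K' w∈K')))
                 (joins-outside u-far k'∉S (clique-close K'-clique u∈K' k'∈K')))

  -- The maximal clique containing Inner is the node required by weak
  -- convergence: every clique-tree edge KK' with S ⊊ K ∩ K' has an end
  -- whose clique lies in Inner.
  convergent : (CT : CliqueTree G) → WeaklyConvergent CT S
  convergent CT with extend-to-maximal Inner inner-clique
  ... | K* , K*-maximal , Inner⊆K* with CliqueTree.surj CT K* K*-maximal
  ... | i , i-is-K* = i , meets
    where
      open CliqueTree CT

      inner-node : ∀ j → clique j ⊆ Inner → i ≡ j
      inner-node j j⊆Inner = inj i j (trans i-is-K*
        (≡-sym (maximal-⊆ K*-maximal (maximal j) (⊆-trans j⊆Inner Inner⊆K*))))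

      clique-of : ∀ j → IsClique G (clique j)
      clique-of j = proj₁ (maximal j)

      meets : ∀ j j' → Adj 𝒯 j j' → S ⊂ (clique j ∩ clique j') → i ≡ j ⊎ i ≡ j'
      meets j j' jj' (S⊆K∩K' , w , w∈K∩K' , w∉S) =
        choose-end (non-adjacent-pair (maximal j) (maximal j') (adj-irrefl 𝒯 jj' ∘ inj j j'))
        where
          S⊆K : S ⊆ clique j
          S⊆K s∈S = proj₁ (x∈p∩q⁻ (clique j) (clique j') (S⊆K∩K' s∈S))
          S⊆K' : S ⊆ clique j'
          S⊆K' s∈S = proj₂ (x∈p∩q⁻ (clique j) (clique j') (S⊆K∩K' s∈S))
          w∈K : w ∈ clique j
          w∈K = proj₁ (x∈p∩q⁻ (clique j) (clique j') w∈K∩K')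
          w∈K' : w ∈ clique j'
          w∈K' = proj₂ (x∈p∩q⁻ (clique j) (clique j') w∈K∩K')

          -- the non-adjacent pair k, k' is not inside the clique Inner
          choose-end : (∃₂ λ k k' → k ∈ clique j × k' ∈ clique j' × k ≢ k' × ¬ Adj G k k') →
                       i ≡ j ⊎ i ≡ j'
          choose-end (k , k' , k∈K , k'∈K' , k≢k' , k≁k') with inner? k | inner? k'
          ... | no k-far | _ = inj₂ (inner-node j' (far-pair-forces-inner (clique-of j) (clique-of j')
                  S⊆K S⊆K' w∈K w∈K' w∉S k∈K k'∈K' k≢k' k≁k' k-far))
          ... | yes _ | no k'-far = inj₁ (inner-node j (far-pair-forces-inner (clique-of j') (clique-of j)
                  S⊆K' S⊆K w∈K' w∈K w∉S k'∈K' k∈K (k≢k' ∘ ≡-sym) (k≁k' ∘ adj-sym G) k'-far))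
          ... | yes k-near | yes k'-near =
                  ⊥-elim (k≁k' (inner-clique k k' (∈⟦⟧⁺ inner? k-near) (∈⟦⟧⁺ inner? k'-near) k≢k'))

lemma5p4 : ∀ {n : ℕ} (G : Graph n) (R : SteinerRoot4 G) (S : Subset n) →
    IsMinimalSeparator G S →
    (∃ λ X → IsSteinerHull (SteinerRoot4.T R) (SteinerRoot4.ι R) S X ×
      NonEdgeStar (SteinerRoot4.T R) X) →
    (CT : CliqueTree G) → WeaklyConvergent CT S
lemma5p4 G R S (a , b , separates , minimal) (X , hull , non-edge-star) =
  StarHull.convergent G R S separates minimal X hull
    (non-edge-star-shape T (proj₂ isTree) X non-edge-star)
  where open SteinerRoot4 R
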